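{- Let $A$ and $B$ be two independent sets in a claw-free graph $G$ such that every connected component of $G[A\Delta B]$ is a cycle. Then for every vertex $v\in V(G)$: if $N[v]\cap A=\emptyset$ then $N[v]\cap B=\emptyset$.
   Context: Graphs are finite and simple; claw-free means no induced $K_{1,3}$. $N[v]=N(v)\cup\{v\}$ is the closed neighbourhood; $A\Delta B=(A\setminus B)\cup(B\setminus A)$. -}

module Defs where

open import Data.Nat using (ℕ; _≥_)
open import Data.Fin using (Fin)
open import Data.List using (List; length)
open import Data.List.Membership.Propositional using (_∈_)
open import Data.List.Relation.Unary.Unique.Propositional using (Unique)
open import Data.Product using (Σ; _×_; _,_)
open import Data.Sum using (_⊎_)
open import Data.Empty using (⊥)
open import Relation.Nullary using (¬_)
open import Relation.Binary.PropositionalEquality using (_≡_)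

record Graph (n : ℕ) : Set₁ where
  field
    Adj     : Fin n → Fin n → Set
    irrefl  : ∀ x → ¬ Adj x x
    sym     : ∀ {x y} → Adj x y → Adj y x

open Graph public

VSet : ℕ → Set₁
VSet n = Fin n → Set

module _ {n : ℕ} (G : Graph n) where

  N[_] : Fin n → VSet n
  N[ v ] u = (u ≡ v) ⊎ Adj G v u

  Independent : VSet n → Set
  Independent A = ∀ x y → A x → A y → ¬ Adj G x y

  ClawFree : Set
  -- (leaves must be pairwise distinct; distinctness from c follows from irreflexivity)
  ClawFree = ∀ c a b d → ¬ a ≡ b → ¬ a ≡ d → ¬ b ≡ d →
             Adj G c a → Adj G c b → Adj G c d →
             ¬ Adj G a b → ¬ Adj G a d → ¬ Adj G b d → ⊥

  data Reach (S : VSet n) : Fin n → Fin n → Set where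
    here : ∀ {x} → S x → Reach S x x
    step : ∀ {x y z} → S x → Adj G x y → Reach S y z → Reach S x z

  Component : VSet n → Fin n → VSet n
  Component S x y = Reach S x y

open import Data.List using (lookup)
open import Data.Fin using (toℕ)
open import Data.Nat using (suc; _%_; NonZero)
open import Data.Nat using (_+_)

module _ {n : ℕ} (G : Graph n) where

  -- The induced subgraph G[C] is a cycle: C is enumerated without repetition
  -- by a list vs of length k ≥ 3, and two vertices of C are adjacent in G
  -- iff they are cyclically consecutive in vs.
  CyclicNeighbours : (vs : List (Fin n)) → Fin n → Fin n → Set
  CyclicNeighbours vs x y =
    Σ (Fin (length vs)) λ i → Σ (Fin (length vs)) λ j →
      (lookup vs i ≡ x) × (lookup vs j ≡ y) ×
      ((suc (toℕ i) ≡ toℕ j) ⊎ (suc (toℕ j) ≡ toℕ i) ⊎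
       ((toℕ i ≡ 0) × (suc (toℕ j) ≡ length vs)) ⊎
       ((toℕ j ≡ 0) × (suc (toℕ i) ≡ length vs)))

  IsCycle : VSet n → Set
  IsCycle C = Σ (List (Fin n)) λ vs →
      (length vs ≥ 3) × Unique vs × (∀ x → C x → x ∈ vs) × (∀ x → x ∈ vs → C x) ×
      (∀ x y → x ∈ vs → y ∈ vs → (Adj G x y → CyclicNeighbours vs x y) × (CyclicNeighbours vs x y → Adj G x y))

  SymDiff : VSet n → VSet n → VSet n
  SymDiff A B x = (A x × ¬ B x) ⊎ (B x × ¬ A x)

  AllComponentsCycles : VSet n → Set
  AllComponentsCycles S = ∀ x → S x → IsCycle (Component G S x)

-- Let u ∈ N[v] ∩ B. Since u ∉ A, u lies on a cycle of G[A Δ B], so it has two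
-- distinct cycle-neighbours y, z; as B is independent they lie in A, and as A is
-- independent they are non-adjacent. Neither is in N[v], so u ≠ v, and then
-- u, v, y, z form a claw.
module Submission where

open import Defs hiding (sym)
open import Data.Nat using (ℕ; zero; suc; _<_; _≤_; s≤s; z≤n; _<?_)
open import Data.Nat.Properties using (≤-antisym; ≤-refl; ≤-trans; <-trans; n<1+n; ≮⇒≥; 1+n≰n)
open import Data.Fin using (Fin; toℕ; fromℕ<) renaming (zero to fzero; suc to fsuc)
open import Data.Fin.Properties using (toℕ-fromℕ<; toℕ<n)
open import Data.Empty using (⊥; ⊥-elim)
open import Data.Product using (_×_; _,_; proj₂; ∃₂)
open import Data.Sum using (_⊎_; inj₁; inj₂)
open import Data.List using (List; _∷_; length; lookup)
open import Data.List.Membership.Propositional using (_∈_)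
open import Data.List.Membership.Propositional.Properties using (∈-lookup)
open import Data.List.Relation.Unary.Any using (index)
open import Data.List.Relation.Unary.Any.Properties using (lookup-index)
open import Data.List.Relation.Unary.All as All using ()
open import Data.List.Relation.Unary.AllPairs using (_∷_)
open import Data.List.Relation.Unary.Unique.Propositional using (Unique)
open import Relation.Nullary using (¬_; yes; no)
open import Relation.Binary.PropositionalEquality
  using (_≡_; _≢_; refl; sym; cong; subst; module ≡-Reasoning)

CyclicallyAdjacent : ℕ → ℕ → ℕ → Set
CyclicallyAdjacent k i j =
  (suc i ≡ j) ⊎ (suc j ≡ i) ⊎ ((i ≡ 0) × (suc j ≡ k)) ⊎ ((j ≡ 0) × (suc i ≡ k))

-- Predecessor and successor modulo k; they differ because k ≥ 3.
cyclic-neighbours : ∀ {k} i → 3 ≤ k → i < k →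
  ∃₂ λ a b → a < k × b < k × a ≢ b ×
             CyclicallyAdjacent k i a × CyclicallyAdjacent k i b
cyclic-neighbours zero (s≤s (s≤s (s≤s {n = m} z≤n))) _ =
  1 , suc (suc m) , s≤s (s≤s z≤n) , ≤-refl , (λ ()) ,
  inj₁ refl , inj₂ (inj₂ (inj₁ (refl , refl)))
cyclic-neighbours {k} (suc i) 3≤k i<k with suc (suc i) <? k
... | yes i+2<k =
  i , suc (suc i) , <-trans (n<1+n i) i<k , i+2<k , (λ ()) ,
  inj₂ (inj₁ refl) , inj₁ refl
... | no i+2≮k =
  i , 0 , <-trans (n<1+n i) i<k , ≤-trans (s≤s z≤n) i<k , i≢0 ,
  inj₂ (inj₁ refl) , inj₂ (inj₂ (inj₂ (refl , i+2≡k)))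
  where
  i+2≡k : suc (suc i) ≡ k
  i+2≡k = ≤-antisym i<k (≮⇒≥ i+2≮k)
  i≢0 : i ≢ 0
  i≢0 refl = 1+n≰n (≤-trans 3≤k (subst (_≤ 2) i+2≡k ≤-refl))

lookup-injective : ∀ {a} {X : Set a} {xs : List X} → Unique xs →
  ∀ i j → lookup xs i ≡ lookup xs j → i ≡ j
lookup-injective (_ ∷ _)     fzero    fzero    _  = refl
lookup-injective (x∉ ∷ _)    fzero    (fsuc j) eq = ⊥-elim (All.lookup x∉ (∈-lookup j) eq)
lookup-injective (x∉ ∷ _)    (fsuc i) fzero    eq = ⊥-elim (All.lookup x∉ (∈-lookup i) (sym eq))
lookup-injective (_ ∷ uniq)  (fsuc i) (fsuc j) eq = cong fsuc (lookup-injective uniq i j eq)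

module _ {n : ℕ} (G : Graph n) where

  Reach-target : ∀ {S x y} → Reach G S x y → S y
  Reach-target (here Sy)     = Sy
  Reach-target (step _ _ r) = Reach-target r

  IsCycle⇒two-neighbours : ∀ {C x} → IsCycle G C → C x →
    ∃₂ λ y z → y ≢ z × C y × C z × Adj G x y × Adj G x z
  IsCycle⇒two-neighbours {C} {x} (vs , 3≤k , uniq , C⊆vs , vs⊆C , adjacency) Cx =
    neighbours (cyclic-neighbours (toℕ i) 3≤k (toℕ<n i))
    where
    k = length vs
    x∈vs : x ∈ vs
    x∈vs = C⊆vs x Cx
    i : Fin k
    i = index x∈vs

    vertex : ∀ {c} → c < k → Fin n
    vertex c<k = lookup vs (fromℕ< c<k)

    adjacent : ∀ {c} (c<k : c < k) → CyclicallyAdjacent k (toℕ i) c → Adj G x (vertex c<k)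
    adjacent c<k i~c = proj₂ (adjacency x _ x∈vs (∈-lookup _))
      (i , fromℕ< c<k , sym (lookup-index x∈vs) , refl ,
       subst (CyclicallyAdjacent k (toℕ i)) (sym (toℕ-fromℕ< c<k)) i~c)

    vertex-injective : ∀ {a b} (a<k : a < k) (b<k : b < k) → vertex a<k ≡ vertex b<k → a ≡ b
    vertex-injective a<k b<k eq = begin
      _                    ≡⟨ sym (toℕ-fromℕ< a<k) ⟩
      toℕ (fromℕ< a<k)     ≡⟨ cong toℕ (lookup-injective uniq _ _ eq) ⟩
      toℕ (fromℕ< b<k)     ≡⟨ toℕ-fromℕ< b<k ⟩
      _                    ∎
      where open ≡-Reasoning

    neighbours : (∃₂ λ a b → a < k × b < k × a ≢ b ×
                   CyclicallyAdjacent k (toℕ i) a × CyclicallyAdjacent k (toℕ i) b) →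
                 ∃₂ λ y z → y ≢ z × C y × C z × Adj G x y × Adj G x z
    neighbours (a , b , a<k , b<k , a≢b , i~a , i~b) =
      vertex a<k , vertex b<k , (λ eq → a≢b (vertex-injective a<k b<k eq)) ,
      vs⊆C _ (∈-lookup _) , vs⊆C _ (∈-lookup _) , adjacent a<k i~a , adjacent b<k i~b

  SymDiff-neighbour-of-B : ∀ A {B u w} → Independent G B → B u → Adj G u w →
    SymDiff G A B w → A w
  SymDiff-neighbour-of-B _ indB Bu uw (inj₁ (Aw , _)) = Aw
  SymDiff-neighbour-of-B _ indB Bu uw (inj₂ (Bw , _)) = ⊥-elim (indB _ _ Bu Bw uw)

  two-neighbours-in-A : ∀ A {B u} → Independent G B →
    AllComponentsCycles G (SymDiff G A B) → B u → ¬ A u →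
    ∃₂ λ y z → y ≢ z × A y × A z × Adj G u y × Adj G u z
  two-neighbours-in-A A {B} {u} indB cycles Bu A∌u
    with IsCycle⇒two-neighbours (cycles u Su) (here Su)
    where
    Su : SymDiff G A B u
    Su = inj₂ (Bu , A∌u)
  ... | y , z , y≢z , Ry , Rz , uy , uz =
    y , z , y≢z ,
    SymDiff-neighbour-of-B A indB Bu uy (Reach-target Ry) ,
    SymDiff-neighbour-of-B A indB Bu uz (Reach-target Rz) ,
    uy , uz

proposition19 : (n : ℕ) (G : Graph n) (A B : VSet n) →
    ClawFree G → Independent G A → Independent G B →
    AllComponentsCycles G (SymDiff G A B) →
    (v : Fin n) → (∀ u → N[_] G v u → A u → ⊥) → (∀ u → N[_] G v u → B u → ⊥)
proposition19 n G A B clawFree indA indB cycles v N[v]∌A u u∈N[v] Bu =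
  claw-at-u (two-neighbours-in-A G A indB cycles Bu (N[v]∌A u u∈N[v])) u∈N[v]
  where
  v≢ : ∀ {w} → A w → v ≢ w
  v≢ Aw refl = N[v]∌A _ (inj₁ refl) Aw
  v≁ : ∀ {w} → A w → ¬ Adj G v w
  v≁ Aw vw = N[v]∌A _ (inj₂ vw) Aw
  claw-at-u : (∃₂ λ y z → y ≢ z × A y × A z × Adj G u y × Adj G u z) → N[_] G v u → ⊥
  claw-at-u (y , z , y≢z , Ay , Az , uy , uz) (inj₁ refl) = v≁ Ay uy
  claw-at-u (y , z , y≢z , Ay , Az , uy , uz) (inj₂ vu) =
    clawFree u v y z (v≢ Ay) (v≢ Az) y≢z (Graph.sym G vu) uy uz (v≁ Ay) (v≁ Az) (indA y z Ay Az)
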